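{- For every integer $n\ge1$ and $m\ge0$, \[ \mathcal{B}_{n,m}^{(k)}(a,q,L)=(-1)^n\sum_{j=1}^{n}\sum_{i=1}^{n}q^{n-j}\,i!\left\{ {n \atop i} \right\}\left\{ {i \atop j} \right\}\widehat{\mathcal{C}}_{j,m}^{(k)}(a,q,L). \]
   Context: Let $k\ge1$ be an integer, $a,q,l_1,\dots,l_k$ nonzero reals, $l=\prod l_i$, $L=(l_1,\dots,l_k)$; denominators $a+j$ ($j\ge0$ integer) assumed nonzero and $l^{a+i}$ means $l^al^i$. Let $s(n,i)$ be the signed Stirling numbers of the first kind ($\frac{1}{i!}(\ln(1+x))^i=\sum_{n\ge i}s(n,i)\frac{x^n}{n!}$) and $\left\{ {n \atop i} \right\}$ the Stirling numbers of the second kind. Define \[ \widehat{\mathcal{C}}_{n,m}^{(k)}(a,q,L)=\frac{(a+m)^k}{a^k}\sum_{i=0}^{n}s(n,i)\frac{(-1)^iq^{n-i}l^{a+i}}{(a+i+m)^k},\qquad \mathcal{B}_{n,m}^{(k)}(a,q,L)=\frac{(a+m)^k}{a^k}\sum_{i=0}^{n}\frac{i!(-q)^{n-i}l^{i+a}}{(a+m+i)^k}\left\{ {n \atop i} \right\}. \] -}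

module Defs where

open import Level using (Level; _⊔_) renaming (suc to lsuc)
open import Algebra.Bundles using (CommutativeRing)
open import Data.Nat as ℕ using (ℕ; zero; suc; _∸_)
open import Data.Nat using (_!)
open import Data.Integer as ℤ using (ℤ; +_; -[1+_])
open import Data.Fin using (Fin)
open import Relation.Nullary using (¬_)

-- Signed Stirling numbers of the first kind s(n,i), via the standard recurrence
-- s(n+1,i+1) = s(n,i) - n s(n,i+1), which is equivalent to the generating function
-- (ln(1+x))^i / i! = Σ_n s(n,i) x^n / n!.
stirling1 : ℕ → ℕ → ℤ
stirling1 zero    zero    = + 1
stirling1 zero    (suc i) = + 0
stirling1 (suc n) zero    = + 0
stirling1 (suc n) (suc i) = stirling1 n i ℤ.- (+ n) ℤ.* stirling1 n (suc i)

stirling2 : ℕ → ℕ → ℕ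
stirling2 zero    zero    = 1
stirling2 zero    (suc i) = 0
stirling2 (suc n) zero    = 0
stirling2 (suc n) (suc i) = suc i ℕ.* stirling2 n (suc i) ℕ.+ stirling2 n i

record Field (c ℓ : Level) : Set (lsuc (c ⊔ ℓ)) where
  field
    commutativeRing : CommutativeRing c ℓ
  open CommutativeRing commutativeRing public
  field
    _⁻¹      : Carrier → Carrier
    1≉0      : ¬ (1# ≈ 0#)
    inverseʳ : ∀ x → ¬ (x ≈ 0#) → x * (x ⁻¹) ≈ 1#

module FieldDefs {c ℓ : Level} (F : Field c ℓ) where
  open Field F

  infixl 7 _/_
  _/_ : Carrier → Carrier → Carrier
  x / y = x * (y ⁻¹)

  infixr 8 _^_
  _^_ : Carrier → ℕ → Carrier
  x ^ zero  = 1#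
  x ^ suc n = x * (x ^ n)

  ι : ℕ → Carrier
  ι zero    = 0#
  ι (suc n) = 1# + ι n

  ιℤ : ℤ → Carrier
  ιℤ (+ n)      = ι n
  ιℤ -[1+ n ]   = - ι (suc n)

  sum0 : ℕ → (ℕ → Carrier) → Carrier
  sum0 zero    f = f 0
  sum0 (suc n) f = sum0 n f + f (suc n)

  sum1 : ℕ → (ℕ → Carrier) → Carrier
  sum1 zero    f = 0#
  sum1 (suc n) f = sum1 n f + f (suc n)

  prod : (k : ℕ) → (Fin k → Carrier) → Carrier
  prod zero    L = 1#
  prod (suc k) L = L Fin.zero * prod k (λ i → L (Fin.suc i))
    where import Data.Fin as Fin

  -- la stands for l^a (l = ∏ l_i); l^(a+i) is read as l^a * l^i.
  Chat : (k : ℕ) → ℕ → ℕ → (a q la : Carrier) → (L : Fin k → Carrier) → Carrier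
  Chat k n m a q la L =
    ((a + ι m) ^ k / a ^ k) *
    sum0 n (λ i → ιℤ (stirling1 n i) * ((- 1#) ^ i * (q ^ (n ∸ i) * (la * prod k L ^ i)))
                  / (a + ι (i ℕ.+ m)) ^ k)

  B : (k : ℕ) → ℕ → ℕ → (a q la : Carrier) → (L : Fin k → Carrier) → Carrier
  B k n m a q la L =
    ((a + ι m) ^ k / a ^ k) *
    sum0 n (λ i → ι (i !) * ((- q) ^ (n ∸ i) * (prod k L ^ i * la))
                  / (a + ι (m ℕ.+ i)) ^ k * ι (stirling2 n i))

-- Substituting the definition of Ĉ_j turns the right-hand side into a triple sum over
-- i, j, t of i! S(n,i) S(i,j) s(j,t) times the t-th term of Ĉ, in which q^(n-j) q^(j-t)
-- merges to q^(n-t).  Summing over j first, the orthogonality relation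
-- Σ_j S(i,j) s(j,t) = δ_it of the Stirling numbers of the two kinds leaves the single
-- sum over i, which is B once (-1)^n (-1)^i is recognised as (-1)^(n-i).
module Submission where

open import Defs
open import Level using (Level)
open import Data.Nat as ℕ using (ℕ; zero; suc; _≤_; _<_; _∸_; _!; z≤n; s≤s)
open import Data.Fin using (Fin)
import Data.Nat.Properties as ℕP
open import Data.Integer as ℤ using (ℤ; +_; -[1+_])
import Data.Integer.Properties as ℤP
open import Data.Maybe using (map)
open import Data.Sum using (inj₁; inj₂)
open import Function using (_∘_)
open import Relation.Nullary using (¬_; yes; no)
open import Relation.Binary.Consequences using (dec⇒weaklyDec)
open import Relation.Binary.PropositionalEquality as ≡ using (_≡_)
open import Algebra.Solver.Ring.AlmostCommutativeRing
  using (_-Raw-AlmostCommutative⟶_; fromCommutativeRing)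
import Algebra.Solver.Ring
import Algebra.Properties.Ring
import Algebra.Properties.AbelianGroup
import Algebra.Properties.CommutativeSemigroup
import Algebra.Properties.Semiring.Mult
import Relation.Binary.Reasoning.Setoid as SetoidReasoning

stirling2-above-diagonal : ∀ {n i} → n < i → stirling2 n i ≡ 0
stirling2-above-diagonal {zero}  {suc i} _ = ≡.refl
stirling2-above-diagonal {suc n} {suc i} (s≤s n<i)
  rewrite stirling2-above-diagonal (ℕP.m<n⇒m<1+n n<i) | stirling2-above-diagonal n<i
  = ≡.trans (ℕP.+-identityʳ _) (ℕP.*-zeroʳ (suc i))

stirling2-column0 : ∀ {n} → 1 ≤ n → stirling2 n 0 ≡ 0
stirling2-column0 (s≤s _) = ≡.refl

stirling2-through-column0 : ∀ {n} → 1 ≤ n → ∀ i → stirling2 n i ℕ.* stirling2 i 0 ≡ 0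
stirling2-through-column0 1≤n zero    = ≡.cong (ℕ._* 1) (stirling2-column0 1≤n)
stirling2-through-column0 {n} _ (suc i) = ℕP.*-zeroʳ (stirling2 n (suc i))

stirling1-above-diagonal : ∀ {n i} → n < i → stirling1 n i ≡ + 0
stirling1-above-diagonal {zero}  {suc i} _ = ≡.refl
stirling1-above-diagonal {suc n} {suc i} (s≤s n<i)
  rewrite stirling1-above-diagonal n<i | stirling1-above-diagonal (ℕP.m<n⇒m<1+n n<i)
        | ℤP.*-zeroʳ (+ n)
  = ≡.refl

module FieldLemmas {c ℓ : Level} (F : Field c ℓ) where
  open Field F hiding (zero)
  open FieldDefs F
  open Algebra.Properties.Ring ring using (-1*x≈-x; -‿distribˡ-*; -‿involutive; -0#≈0#)
  open Algebra.Properties.AbelianGroup +-abelianGroup using (⁻¹-∙-comm)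
  open Algebra.Properties.CommutativeSemigroup +-commutativeSemigroup using (interchange)
  open Algebra.Properties.Semiring.Mult semiring using (_×_; ×-homo-+; ×1-homo-*)
  open SetoidReasoning setoid

  ι≈×1# : ∀ n → ι n ≈ n × 1#
  ι≈×1# zero    = refl
  ι≈×1# (suc n) = +-congˡ (ι≈×1# n)

  ι-1 : ι 1 ≈ 1#
  ι-1 = +-identityʳ 1#

  ι-+ : ∀ m n → ι (m ℕ.+ n) ≈ ι m + ι n
  ι-+ m n = begin
    ι (m ℕ.+ n)      ≈⟨ ι≈×1# (m ℕ.+ n) ⟩
    (m ℕ.+ n) × 1#   ≈⟨ ×-homo-+ 1# m n ⟩
    m × 1# + n × 1#  ≈⟨ +-cong (ι≈×1# m) (ι≈×1# n) ⟨
    ι m + ι n        ∎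

  ι-* : ∀ m n → ι (m ℕ.* n) ≈ ι m * ι n
  ι-* m n = begin
    ι (m ℕ.* n)         ≈⟨ ι≈×1# (m ℕ.* n) ⟩
    (m ℕ.* n) × 1#      ≈⟨ ×1-homo-* m n ⟩
    (m × 1#) * (n × 1#) ≈⟨ *-cong (ι≈×1# m) (ι≈×1# n) ⟨
    ι m * ι n           ∎

  ιℤ-⊖ : ∀ m n → ιℤ (m ℤ.⊖ n) ≈ ι m - ι n
  ιℤ-⊖ m zero rewrite ℤP.⊖-≥ {m} {0} z≤n = sym (trans (+-congˡ -0#≈0#) (+-identityʳ _))
  ιℤ-⊖ zero (suc n) rewrite ℤP.⊖-≤ {0} {suc n} z≤n = sym (+-identityˡ _)
  ιℤ-⊖ (suc m) (suc n) rewrite ℤP.[1+m]⊖[1+n]≡m⊖n m n = begin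
    ιℤ (m ℤ.⊖ n)              ≈⟨ ιℤ-⊖ m n ⟩
    ι m - ι n                 ≈⟨ +-identityˡ _ ⟨
    0# + (ι m - ι n)          ≈⟨ +-congʳ (-‿inverseʳ 1#) ⟨
    (1# - 1#) + (ι m - ι n)   ≈⟨ interchange 1# (- 1#) (ι m) (- ι n) ⟩
    (1# + ι m) + (- 1# - ι n) ≈⟨ +-congˡ (⁻¹-∙-comm 1# (ι n)) ⟩
    (1# + ι m) - (1# + ι n)   ∎

  ιℤ-neg : ∀ x → ιℤ (ℤ.- x) ≈ - ιℤ x
  ιℤ-neg (+ zero)  = sym -0#≈0#
  ιℤ-neg (+ suc n) = refl
  ιℤ-neg -[1+ n ]  = sym (-‿involutive _)

  ιℤ-+ : ∀ x y → ιℤ (x ℤ.+ y) ≈ ιℤ x + ιℤ y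
  ιℤ-+ (+ m)    (+ n)    = ι-+ m n
  ιℤ-+ (+ m)    -[1+ n ] = ιℤ-⊖ m (suc n)
  ιℤ-+ -[1+ m ] (+ n)    = trans (ιℤ-⊖ n (suc m)) (+-comm _ _)
  ιℤ-+ -[1+ m ] -[1+ n ] = begin
    - (1# + (1# + ι (m ℕ.+ n))) ≈⟨ -‿cong (+-congˡ (+-congˡ (ι-+ m n))) ⟩
    - (1# + (1# + (ι m + ι n))) ≈⟨ -‿cong (+-assoc 1# 1# _) ⟨
    - ((1# + 1#) + (ι m + ι n)) ≈⟨ -‿cong (interchange 1# 1# (ι m) (ι n)) ⟩
    - ((1# + ι m) + (1# + ι n)) ≈⟨ ⁻¹-∙-comm _ _ ⟨
    - (1# + ι m) + - (1# + ι n) ∎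

  ιℤ-+* : ∀ n y → ιℤ (+ n ℤ.* y) ≈ ι n * ιℤ y
  ιℤ-+* zero y rewrite ℤP.*-zeroˡ y = sym (zeroˡ _)
  ιℤ-+* (suc n) y rewrite ℤP.suc-* (+ n) y = begin
    ιℤ (y ℤ.+ + n ℤ.* y)   ≈⟨ ιℤ-+ y (+ n ℤ.* y) ⟩
    ιℤ y + ιℤ (+ n ℤ.* y)  ≈⟨ +-congˡ (ιℤ-+* n y) ⟩
    ιℤ y + ι n * ιℤ y      ≈⟨ +-congʳ (*-identityˡ _) ⟨
    1# * ιℤ y + ι n * ιℤ y ≈⟨ distribʳ _ _ _ ⟨
    (1# + ι n) * ιℤ y      ∎

  ιℤ-* : ∀ x y → ιℤ (x ℤ.* y) ≈ ιℤ x * ιℤ y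
  ιℤ-* (+ n)    y = ιℤ-+* n y
  ιℤ-* -[1+ n ] y = begin
    ιℤ (-[1+ n ] ℤ.* y)        ≡⟨ ≡.cong ιℤ (ℤP.neg-distribˡ-* (+ suc n) y) ⟨
    ιℤ (ℤ.- (+ suc n ℤ.* y))   ≈⟨ ιℤ-neg (+ suc n ℤ.* y) ⟩
    - ιℤ (+ suc n ℤ.* y)       ≈⟨ -‿cong (ιℤ-+* (suc n) y) ⟩
    - (ι (suc n) * ιℤ y)       ≈⟨ -‿distribˡ-* _ _ ⟩
    - ι (suc n) * ιℤ y         ∎

  ιℤ-homomorphism : ℤ.+-*-rawRing -Raw-AlmostCommutative⟶ fromCommutativeRing commutativeRing
  ιℤ-homomorphism = record
    { ⟦_⟧ = ιℤ ; +-homo = ιℤ-+ ; *-homo = ιℤ-* ; -‿homo = ιℤ-neg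
    ; 0-homo = refl ; 1-homo = ι-1 }

  open Algebra.Solver.Ring ℤ.+-*-rawRing (fromCommutativeRing commutativeRing) ιℤ-homomorphism
    (λ x y → map (reflexive ∘ ≡.cong ιℤ) (dec⇒weaklyDec ℤ._≟_ x y))
    using (solve; _:=_; _:+_; _:-_; _:*_)

  sum0-cong : ∀ N {f g : ℕ → Carrier} → (∀ i → i ≤ N → f i ≈ g i) → sum0 N f ≈ sum0 N g
  sum0-cong zero    f≈g = f≈g 0 z≤n
  sum0-cong (suc N) f≈g =
    +-cong (sum0-cong N (λ i i≤N → f≈g i (ℕP.m≤n⇒m≤1+n i≤N))) (f≈g (suc N) ℕP.≤-refl)

  sum0-zero : ∀ N {f : ℕ → Carrier} → (∀ i → f i ≈ 0#) → sum0 N f ≈ 0#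
  sum0-zero zero    f≈0 = f≈0 0
  sum0-zero (suc N) f≈0 = trans (+-cong (sum0-zero N f≈0) (f≈0 (suc N))) (+-identityʳ 0#)

  sum0-+ : ∀ N (f g : ℕ → Carrier) → sum0 N (λ i → f i + g i) ≈ sum0 N f + sum0 N g
  sum0-+ zero    f g = refl
  sum0-+ (suc N) f g = trans (+-congʳ (sum0-+ N f g)) (interchange _ _ _ _)

  sum0-*ˡ : ∀ N x (f : ℕ → Carrier) → x * sum0 N f ≈ sum0 N (λ i → x * f i)
  sum0-*ˡ zero    x f = refl
  sum0-*ˡ (suc N) x f = trans (distribˡ x _ _) (+-congʳ (sum0-*ˡ N x f))

  sum0-*ʳ : ∀ N x (f : ℕ → Carrier) → sum0 N f * x ≈ sum0 N (λ i → f i * x)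
  sum0-*ʳ zero    x f = refl
  sum0-*ʳ (suc N) x f = trans (distribʳ x _ _) (+-congʳ (sum0-*ʳ N x f))

  sum0-comm : ∀ N M (f : ℕ → ℕ → Carrier) →
    sum0 N (λ i → sum0 M (f i)) ≈ sum0 M (λ j → sum0 N (λ i → f i j))
  sum0-comm zero    M f = refl
  sum0-comm (suc N) M f =
    trans (+-congʳ (sum0-comm N M f)) (sym (sum0-+ M (λ j → sum0 N (λ i → f i j)) (f (suc N))))

  sum0-*-sum0 : ∀ N M (f : ℕ → Carrier) (g : ℕ → ℕ → Carrier) →
    sum0 N (λ i → f i * sum0 M (g i)) ≈ sum0 M (λ j → sum0 N (λ i → f i * g i j))
  sum0-*-sum0 N M f g =
    trans (sum0-cong N (λ i _ → sum0-*ˡ M (f i) (g i))) (sum0-comm N M (λ i j → f i * g i j))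

  sum0-suc : ∀ N (f : ℕ → Carrier) → sum0 (suc N) f ≈ f 0 + sum0 N (f ∘ suc)
  sum0-suc zero    f = refl
  sum0-suc (suc N) f = trans (+-congʳ (sum0-suc N f)) (+-assoc _ _ _)

  sum0-pad : ∀ j N (f : ℕ → Carrier) → j ≤ N → (∀ t → j < t → f t ≈ 0#) → sum0 j f ≈ sum0 N f
  sum0-pad zero zero f z≤n _ = refl
  sum0-pad j (suc N) f j≤1+N f≈0 with ℕP.m≤n⇒m<n∨m≡n j≤1+N
  ... | inj₂ ≡.refl       = refl
  ... | inj₁ (s≤s j≤N) = begin
    sum0 j f                ≈⟨ sum0-pad j N f j≤N f≈0 ⟩
    sum0 N f                ≈⟨ +-identityʳ _ ⟨
    sum0 N f + 0#           ≈⟨ +-congˡ (f≈0 (suc N) (s≤s j≤N)) ⟨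
    sum0 N f + f (suc N)    ∎

  sum0-telescope : ∀ N (g : ℕ → Carrier) → sum0 N (λ j → g (suc j) - g j) ≈ g (suc N) - g 0
  sum0-telescope zero    g = refl
  sum0-telescope (suc N) g = trans (+-congʳ (sum0-telescope N g))
    (solve 3 (λ x y z → (y :- x) :+ (z :- y) := z :- x) refl _ _ _)

  sum1≈sum0 : ∀ N (f : ℕ → Carrier) → f 0 ≈ 0# → sum1 N f ≈ sum0 N f
  sum1≈sum0 zero    f f0≈0 = sym f0≈0
  sum1≈sum0 (suc N) f f0≈0 = +-congʳ (sum1≈sum0 N f f0≈0)

  sum1²≈sum0² : ∀ N (f : ℕ → ℕ → Carrier) → (∀ j → f j 0 ≈ 0#) → (∀ i → f 0 i ≈ 0#) →
    sum1 N (λ j → sum1 N (f j)) ≈ sum0 N (λ j → sum0 N (f j))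
  sum1²≈sum0² N f f-0≈0 f0-≈0 = begin
    sum1 N (λ j → sum1 N (f j)) ≈⟨ sum1-cong N ⟩
    sum1 N (λ j → sum0 N (f j)) ≈⟨ sum1≈sum0 N _ (sum0-zero N f0-≈0) ⟩
    sum0 N (λ j → sum0 N (f j)) ∎
    where
    sum1-cong : ∀ M → sum1 M (λ j → sum1 N (f j)) ≈ sum1 M (λ j → sum0 N (f j))
    sum1-cong zero    = refl
    sum1-cong (suc M) = +-cong (sum1-cong M) (sum1≈sum0 N (f (suc M)) (f-0≈0 (suc M)))

  δ : ℕ → ℕ → Carrier
  δ zero    zero    = 1#
  δ zero    (suc t) = 0#
  δ (suc i) zero    = 0#
  δ (suc i) (suc t) = δ i t

  sum0-δ : ∀ N i (u : ℕ → Carrier) → i ≤ N → sum0 N (λ t → δ i t * u t) ≈ u i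
  sum0-δ N zero u _ = begin
    sum0 N (λ t → δ 0 t * u t)
      ≈⟨ sum0-pad 0 N _ z≤n (λ { (suc t) _ → zeroˡ (u (suc t)) }) ⟨
    1# * u 0
      ≈⟨ *-identityˡ (u 0) ⟩
    u 0 ∎
  sum0-δ (suc N) (suc i) u (s≤s i≤N) = begin
    sum0 (suc N) (λ t → δ (suc i) t * u t)
      ≈⟨ sum0-suc N _ ⟩
    0# * u 0 + sum0 N (λ t → δ i t * u (suc t))
      ≈⟨ +-cong (zeroˡ (u 0)) (sum0-δ N i (u ∘ suc) i≤N) ⟩
    0# + u (suc i)
      ≈⟨ +-identityˡ _ ⟩
    u (suc i) ∎

  S₂ : ℕ → ℕ → Carrier
  S₂ n i = ι (stirling2 n i)

  s₁ : ℕ → ℕ → Carrier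
  s₁ n i = ιℤ (stirling1 n i)

  S₂-suc-suc : ∀ n i → S₂ (suc n) (suc i) ≈ ι (suc i) * S₂ n (suc i) + S₂ n i
  S₂-suc-suc n i =
    trans (ι-+ (suc i ℕ.* stirling2 n (suc i)) _) (+-congʳ (ι-* (suc i) (stirling2 n (suc i))))

  s₁-suc-suc : ∀ n i → s₁ (suc n) (suc i) ≈ s₁ n i - ι n * s₁ n (suc i)
  s₁-suc-suc n i = trans (ιℤ-+ (stirling1 n i) _)
    (+-congˡ (trans (ιℤ-neg (+ n ℤ.* stirling1 n (suc i))) (-‿cong (ιℤ-+* n _))))

  s₁-above-diagonal : ∀ {n i} → n < i → s₁ n i ≈ 0#
  s₁-above-diagonal n<i = reflexive (≡.cong ιℤ (stirling1-above-diagonal n<i))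

  s₁-*-cong : ∀ {n i x y} → (i ≤ n → x ≈ y) → s₁ n i * x ≈ s₁ n i * y
  s₁-*-cong {n} {i} {x} {y} x≈y with i ℕP.≤? n
  ... | yes i≤n = *-congˡ (x≈y i≤n)
  ... | no  i≰n = begin
    s₁ n i * x ≈⟨ *-congʳ (s₁-above-diagonal (ℕP.≰⇒> i≰n)) ⟩
    0# * x     ≈⟨ zeroˡ x ⟩
    0#         ≈⟨ zeroˡ y ⟨
    0# * y     ≈⟨ *-congʳ (s₁-above-diagonal (ℕP.≰⇒> i≰n)) ⟨
    s₁ n i * y ∎

  S₂s₁-suc-suc : ∀ i j t →
    S₂ (suc i) (suc j) * s₁ (suc j) (suc t)
      ≈ S₂ i j * s₁ j t + (ι (suc j) * S₂ i (suc j) * s₁ (suc j) (suc t) - ι j * S₂ i j * s₁ j (suc t))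
  S₂s₁-suc-suc i j t = begin
    S₂ (suc i) (suc j) * s₁ (suc j) (suc t)
      ≈⟨ *-congʳ (S₂-suc-suc i j) ⟩
    (ι (suc j) * S₂ i (suc j) + S₂ i j) * s₁ (suc j) (suc t)
      ≈⟨ distribʳ _ _ _ ⟩
    ι (suc j) * S₂ i (suc j) * s₁ (suc j) (suc t) + S₂ i j * s₁ (suc j) (suc t)
      ≈⟨ +-congˡ (*-congˡ (s₁-suc-suc j t)) ⟩
    ι (suc j) * S₂ i (suc j) * s₁ (suc j) (suc t) + S₂ i j * (s₁ j t - ι j * s₁ j (suc t))
      ≈⟨ solve 5 (λ x y z u v → x :+ y :* (z :- u :* v) := y :* z :+ (x :- u :* y :* v))
           refl _ _ _ _ _ ⟩
    S₂ i j * s₁ j t + (ι (suc j) * S₂ i (suc j) * s₁ (suc j) (suc t) - ι j * S₂ i j * s₁ j (suc t)) ∎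

  stirling-orthogonality : ∀ N i t → i ≤ N → sum0 N (λ j → S₂ i j * s₁ j t) ≈ δ i t
  stirling-orthogonality N zero t _ = begin
    sum0 N (λ j → S₂ 0 j * s₁ j t)
      ≈⟨ sum0-pad 0 N _ z≤n (λ { (suc j) _ → zeroˡ (s₁ (suc j) t) }) ⟨
    S₂ 0 0 * s₁ 0 t
      ≈⟨ row0 t ⟩
    δ 0 t ∎
    where
    row0 : ∀ t → S₂ 0 0 * s₁ 0 t ≈ δ 0 t
    row0 zero    = trans (*-cong ι-1 ι-1) (*-identityˡ 1#)
    row0 (suc t) = zeroʳ _
  stirling-orthogonality (suc N) (suc i) t (s≤s i≤N) = begin
    sum0 (suc N) (λ j → S₂ (suc i) j * s₁ j t)
      ≈⟨ sum0-suc N _ ⟩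
    0# * s₁ 0 t + sum0 N (λ j → S₂ (suc i) (suc j) * s₁ (suc j) t)
      ≈⟨ trans (+-congʳ (zeroˡ _)) (+-identityˡ _) ⟩
    sum0 N (λ j → S₂ (suc i) (suc j) * s₁ (suc j) t)
      ≈⟨ shifted t ⟩
    δ (suc i) t ∎
    where
    shifted : ∀ t → sum0 N (λ j → S₂ (suc i) (suc j) * s₁ (suc j) t) ≈ δ (suc i) t
    shifted zero    = sum0-zero N (λ j → zeroʳ _)
    shifted (suc t) = begin
      sum0 N (λ j → S₂ (suc i) (suc j) * s₁ (suc j) (suc t))
        ≈⟨ sum0-cong N (λ j _ → S₂s₁-suc-suc i j t) ⟩
      sum0 N (λ j → S₂ i j * s₁ j t + (g (suc j) - g j))
        ≈⟨ sum0-+ N _ _ ⟩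
      sum0 N (λ j → S₂ i j * s₁ j t) + sum0 N (λ j → g (suc j) - g j)
        ≈⟨ +-cong (stirling-orthogonality N i t i≤N) (sum0-telescope N g) ⟩
      δ i t + (g (suc N) - g 0)
        ≈⟨ +-congˡ (+-cong g[1+N]≈0 (-‿cong g0≈0)) ⟩
      δ i t + (0# - 0#)
        ≈⟨ trans (+-congˡ (-‿inverseʳ 0#)) (+-identityʳ _) ⟩
      δ i t ∎
      where
      g : ℕ → Carrier
      g j = ι j * S₂ i j * s₁ j (suc t)
      g[1+N]≈0 : g (suc N) ≈ 0#
      g[1+N]≈0 = begin
        ι (suc N) * S₂ i (suc N) * s₁ (suc N) (suc t)
          ≈⟨ *-congʳ (*-congˡ (reflexive (≡.cong ι (stirling2-above-diagonal (s≤s i≤N))))) ⟩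
        ι (suc N) * 0# * s₁ (suc N) (suc t)
          ≈⟨ trans (*-congʳ (zeroʳ _)) (zeroˡ _) ⟩
        0# ∎
      g0≈0 : g 0 ≈ 0#
      g0≈0 = trans (*-congʳ (zeroˡ _)) (zeroˡ _)

  stirling-inversion : ∀ N i (v : ℕ → Carrier) → i ≤ N →
    sum0 N (λ j → S₂ i j * sum0 N (λ t → s₁ j t * v t)) ≈ v i
  stirling-inversion N i v i≤N = begin
    sum0 N (λ j → S₂ i j * sum0 N (λ t → s₁ j t * v t))
      ≈⟨ sum0-*-sum0 N N (S₂ i) (λ j t → s₁ j t * v t) ⟩
    sum0 N (λ t → sum0 N (λ j → S₂ i j * (s₁ j t * v t)))
      ≈⟨ sum0-cong N (λ t _ → sum0-cong N (λ j _ → *-assoc _ _ _)) ⟨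
    sum0 N (λ t → sum0 N (λ j → S₂ i j * s₁ j t * v t))
      ≈⟨ sum0-cong N (λ t _ → sum0-*ʳ N (v t) (λ j → S₂ i j * s₁ j t)) ⟨
    sum0 N (λ t → sum0 N (λ j → S₂ i j * s₁ j t) * v t)
      ≈⟨ sum0-cong N (λ t _ → *-congʳ (stirling-orthogonality N i t i≤N)) ⟩
    sum0 N (λ t → δ i t * v t)
      ≈⟨ sum0-δ N i v i≤N ⟩
    v i ∎

  ^-congˡ : ∀ {x y} → x ≈ y → ∀ n → x ^ n ≈ y ^ n
  ^-congˡ x≈y zero    = refl
  ^-congˡ x≈y (suc n) = *-cong x≈y (^-congˡ x≈y n)

  ^-+ : ∀ x m n → x ^ (m ℕ.+ n) ≈ x ^ m * x ^ n
  ^-+ x zero    n = sym (*-identityˡ _)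
  ^-+ x (suc m) n = trans (*-congˡ (^-+ x m n)) (sym (*-assoc _ _ _))

  ^-distribʳ-* : ∀ x y n → (x * y) ^ n ≈ x ^ n * y ^ n
  ^-distribʳ-* x y zero    = sym (*-identityˡ 1#)
  ^-distribʳ-* x y (suc n) = trans (*-congˡ (^-distribʳ-* x y n))
    (solve 4 (λ x y u v → x :* y :* (u :* v) := x :* u :* (y :* v)) refl x y _ _)

  1^n≈1 : ∀ n → 1# ^ n ≈ 1#
  1^n≈1 zero    = refl
  1^n≈1 (suc n) = trans (*-identityˡ _) (1^n≈1 n)

  ^-∸-merge : ∀ x {t j n} → t ≤ j → j ≤ n → x ^ (n ∸ j) * x ^ (j ∸ t) ≈ x ^ (n ∸ t)
  ^-∸-merge x {t} {j} {n} t≤j j≤n = begin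
    x ^ (n ∸ j) * x ^ (j ∸ t) ≈⟨ ^-+ x (n ∸ j) (j ∸ t) ⟨
    x ^ (n ∸ j ℕ.+ (j ∸ t))   ≡⟨ ≡.cong (x ^_) exponents ⟩
    x ^ (n ∸ t)               ∎
    where
    exponents : n ∸ j ℕ.+ (j ∸ t) ≡ n ∸ t
    exponents = ≡.trans (≡.sym (ℕP.+-∸-assoc (n ∸ j) t≤j)) (≡.cong (_∸ t) (ℕP.m∸n+n≡m j≤n))

  -1^n*-1^n≈1 : ∀ n → (- 1#) ^ n * (- 1#) ^ n ≈ 1#
  -1^n*-1^n≈1 n = begin
    (- 1#) ^ n * (- 1#) ^ n ≈⟨ ^-distribʳ-* (- 1#) (- 1#) n ⟨
    (- 1# * - 1#) ^ n       ≈⟨ ^-congˡ (trans (-1*x≈-x (- 1#)) (-‿involutive 1#)) n ⟩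
    1# ^ n                  ≈⟨ 1^n≈1 n ⟩
    1#                      ∎

  -x^n≈-1^n*x^n : ∀ x n → (- x) ^ n ≈ (- 1#) ^ n * x ^ n
  -x^n≈-1^n*x^n x n = trans (^-congˡ (sym (-1*x≈-x x)) n) (^-distribʳ-* (- 1#) x n)

  -1^[n∸i] : ∀ {i n} → i ≤ n → (- 1#) ^ (n ∸ i) ≈ (- 1#) ^ n * (- 1#) ^ i
  -1^[n∸i] {i} {n} i≤n = begin
    ε ^ (n ∸ i)                       ≈⟨ *-identityʳ _ ⟨
    ε ^ (n ∸ i) * 1#                  ≈⟨ *-congˡ (-1^n*-1^n≈1 i) ⟨
    ε ^ (n ∸ i) * (ε ^ i * ε ^ i)     ≈⟨ *-assoc _ _ _ ⟨
    ε ^ (n ∸ i) * ε ^ i * ε ^ i       ≈⟨ *-congʳ (^-+ ε (n ∸ i) i) ⟨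
    ε ^ (n ∸ i ℕ.+ i) * ε ^ i         ≡⟨ ≡.cong (λ e → ε ^ e * ε ^ i) (ℕP.m∸n+n≡m i≤n) ⟩
    ε ^ n * ε ^ i                     ∎
    where
    ε : Carrier
    ε = - 1#

  module Expansion (k : ℕ) (a q la : Carrier) (L : Fin k → Carrier) (m n : ℕ) where

    scale : Carrier
    scale = (a + ι m) ^ k / a ^ k

    P : Carrier
    P = prod k L

    d : ℕ → Carrier
    d t = (a + ι (t ℕ.+ m)) ^ k

    w : ℕ → Carrier
    w t = scale * ((- 1#) ^ t * (q ^ (n ∸ t) * (la * P ^ t)) / d t)

    scaled-Chat : ∀ j → j ≤ n → q ^ (n ∸ j) * Chat k j m a q la L ≈ sum0 n (λ t → s₁ j t * w t)
    scaled-Chat j j≤n = begin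
      q ^ (n ∸ j) * (scale * sum0 j ĉ)
        ≈⟨ *-congˡ (*-congˡ (sum0-pad j n ĉ j≤n ĉ-vanishes)) ⟩
      q ^ (n ∸ j) * (scale * sum0 n ĉ)
        ≈⟨ *-congˡ (sum0-*ˡ n scale ĉ) ⟩
      q ^ (n ∸ j) * sum0 n (λ t → scale * ĉ t)
        ≈⟨ sum0-*ˡ n _ _ ⟩
      sum0 n (λ t → q ^ (n ∸ j) * (scale * ĉ t))
        ≈⟨ sum0-cong n (λ t _ → balance t) ⟩
      sum0 n (λ t → s₁ j t * w t) ∎
      where
      ĉ : ℕ → Carrier
      ĉ t = s₁ j t * ((- 1#) ^ t * (q ^ (j ∸ t) * (la * P ^ t))) / d t
      ĉ-vanishes : ∀ t → j < t → ĉ t ≈ 0#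
      ĉ-vanishes t j<t =
        trans (*-congʳ (trans (*-congʳ (s₁-above-diagonal j<t)) (zeroˡ _))) (zeroˡ _)
      balance : ∀ t → q ^ (n ∸ j) * (scale * ĉ t) ≈ s₁ j t * w t
      balance t = begin
        q ^ (n ∸ j) * (scale * ĉ t)
          ≈⟨ solve 7 (λ x y s σ ε p v →
                 x :* (σ :* (s :* (ε :* (y :* p)) :* v)) := s :* (σ :* (ε :* (x :* y :* p) :* v)))
               refl (q ^ (n ∸ j)) (q ^ (j ∸ t)) (s₁ j t) scale ((- 1#) ^ t) (la * P ^ t) (d t ⁻¹) ⟩
        s₁ j t * (scale * ((- 1#) ^ t * (q ^ (n ∸ j) * q ^ (j ∸ t) * (la * P ^ t)) / d t))
          ≈⟨ s₁-*-cong (λ t≤j → *-congˡ (*-congʳ (*-congˡ (*-congʳ (^-∸-merge q t≤j j≤n))))) ⟩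
        s₁ j t * w t ∎

    B≈signed-sum : B k n m a q la L ≈ (- 1#) ^ n * sum0 n (λ i → ι (i !) * S₂ n i * w i)
    B≈signed-sum = begin
      scale * sum0 n b
        ≈⟨ sum0-*ˡ n scale b ⟩
      sum0 n (λ i → scale * b i)
        ≈⟨ sum0-cong n term ⟩
      sum0 n (λ i → (- 1#) ^ n * (ι (i !) * S₂ n i * w i))
        ≈⟨ sum0-*ˡ n _ _ ⟨
      (- 1#) ^ n * sum0 n (λ i → ι (i !) * S₂ n i * w i) ∎
      where
      b : ℕ → Carrier
      b i = ι (i !) * ((- q) ^ (n ∸ i) * (P ^ i * la)) / (a + ι (m ℕ.+ i)) ^ k * S₂ n i
      term : ∀ i → i ≤ n → scale * b i ≈ (- 1#) ^ n * (ι (i !) * S₂ n i * w i)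
      term i i≤n = begin
        scale * b i
          ≈⟨ solve 7 (λ f S σ x p l v →
                 σ :* (f :* (x :* (p :* l)) :* v :* S) := x :* (f :* S :* σ :* p :* l :* v))
               refl (ι (i !)) (S₂ n i) scale ((- q) ^ (n ∸ i)) (P ^ i) la (((a + ι (m ℕ.+ i)) ^ k) ⁻¹) ⟩
        (- q) ^ (n ∸ i) * (Q * ((a + ι (m ℕ.+ i)) ^ k) ⁻¹)
          ≡⟨ ≡.cong (λ e → (- q) ^ (n ∸ i) * (Q * ((a + ι e) ^ k) ⁻¹)) (ℕP.+-comm m i) ⟩
        (- q) ^ (n ∸ i) * (Q * d i ⁻¹)
          ≈⟨ *-congʳ (-x^n≈-1^n*x^n q (n ∸ i)) ⟩
        (- 1#) ^ (n ∸ i) * q ^ (n ∸ i) * (Q * d i ⁻¹)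
          ≈⟨ *-congʳ (*-congʳ (-1^[n∸i] i≤n)) ⟩
        (- 1#) ^ n * (- 1#) ^ i * q ^ (n ∸ i) * (Q * d i ⁻¹)
          ≈⟨ solve 9 (λ e ε y f S σ p l v →
                 e :* ε :* y :* (f :* S :* σ :* p :* l :* v)
                   := e :* (f :* S :* (σ :* (ε :* (y :* (l :* p)) :* v))))
               refl ((- 1#) ^ n) ((- 1#) ^ i) (q ^ (n ∸ i)) (ι (i !)) (S₂ n i) scale (P ^ i) la
               (d i ⁻¹) ⟩
        (- 1#) ^ n * (ι (i !) * S₂ n i * w i) ∎
        where
        Q : Carrier
        Q = ι (i !) * S₂ n i * scale * P ^ i * la

    summand : ℕ → ℕ → Carrier
    summand j i = q ^ (n ∸ j) * ι (i !) * S₂ n i * S₂ i j * Chat k j m a q la L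

    summand-factor : ∀ j i →
      ι (i !) * S₂ n i * (S₂ i j * (q ^ (n ∸ j) * Chat k j m a q la L)) ≈ summand j i
    summand-factor j i =
      solve 5 (λ f S T x C → f :* S :* (T :* (x :* C)) := x :* f :* S :* T :* C) refl _ _ _ _ _

    summand-column0 : 1 ≤ n → ∀ j → summand j 0 ≈ 0#
    summand-column0 1≤n j = begin
      summand j 0
        ≈⟨ solve 5 (λ x f S T C → x :* f :* S :* T :* C := S :* (x :* f :* T :* C)) refl
             (q ^ (n ∸ j)) (ι (0 !)) (S₂ n 0) (S₂ 0 j) (Chat k j m a q la L) ⟩
      S₂ n 0 * (q ^ (n ∸ j) * ι (0 !) * S₂ 0 j * Chat k j m a q la L)
        ≈⟨ *-congʳ (reflexive (≡.cong ι (stirling2-column0 1≤n))) ⟩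
      0# * (q ^ (n ∸ j) * ι (0 !) * S₂ 0 j * Chat k j m a q la L)
        ≈⟨ zeroˡ _ ⟩
      0# ∎

    summand-row0 : 1 ≤ n → ∀ i → summand 0 i ≈ 0#
    summand-row0 1≤n i = begin
      summand 0 i
        ≈⟨ solve 5 (λ x f S T C → x :* f :* S :* T :* C := S :* T :* (x :* f :* C)) refl
             (q ^ n) (ι (i !)) (S₂ n i) (S₂ i 0) (Chat k 0 m a q la L) ⟩
      S₂ n i * S₂ i 0 * (q ^ n * ι (i !) * Chat k 0 m a q la L)
        ≈⟨ *-congʳ (ι-* (stirling2 n i) (stirling2 i 0)) ⟨
      ι (stirling2 n i ℕ.* stirling2 i 0) * (q ^ n * ι (i !) * Chat k 0 m a q la L)
        ≈⟨ *-congʳ (reflexive (≡.cong ι (stirling2-through-column0 1≤n i))) ⟩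
      0# * (q ^ n * ι (i !) * Chat k 0 m a q la L)
        ≈⟨ zeroˡ _ ⟩
      0# ∎

theorem10 : ∀ {c ℓ : Level} (F : Field c ℓ) →
    let open Field F
        open FieldDefs F
    in (k : ℕ) → 1 ≤ k →
       (a q la : Carrier) → (L : Fin k → Carrier) →
       ¬ (a ≈ 0#) → ¬ (q ≈ 0#) → (∀ i → ¬ (L i ≈ 0#)) → ¬ (la ≈ 0#) →
       (∀ (j : ℕ) → ¬ ((a + ι j) ≈ 0#)) →
       (n m : ℕ) → 1 ≤ n →
       B k n m a q la L ≈
         (- 1#) ^ n * sum1 n (λ j → sum1 n (λ i →
            q ^ (n ∸ j) * ι (i !) * ι (stirling2 n i) * ι (stirling2 i j)
              * Chat k j m a q la L))
theorem10 F k _ a q la L _ _ _ _ _ n m 1≤n = begin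
  B k n m a q la L
    ≈⟨ B≈signed-sum ⟩
  ± * sum0 n (λ i → ι (i !) * S₂ n i * w i)
    ≈⟨ *-congˡ (sum0-cong n (λ i i≤n → *-congˡ (stirling-inversion n i w i≤n))) ⟨
  ± * sum0 n (λ i → ι (i !) * S₂ n i * sum0 n (λ j → S₂ i j * sum0 n (λ t → s₁ j t * w t)))
    ≈⟨ *-congˡ (sum0-cong n (λ i _ →
         *-congˡ (sum0-cong n (λ j j≤n → *-congˡ (scaled-Chat j j≤n))))) ⟨
  ± * sum0 n (λ i → ι (i !) * S₂ n i * sum0 n (λ j → S₂ i j * qĈ j))
    ≈⟨ *-congˡ (sum0-*-sum0 n n _ _) ⟩
  ± * sum0 n (λ j → sum0 n (λ i → ι (i !) * S₂ n i * (S₂ i j * qĈ j)))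
    ≈⟨ *-congˡ (sum0-cong n (λ j _ → sum0-cong n (λ i _ → summand-factor j i))) ⟩
  ± * sum0 n (λ j → sum0 n (summand j))
    ≈⟨ *-congˡ (sum1²≈sum0² n summand (summand-column0 1≤n) (summand-row0 1≤n)) ⟨
  ± * sum1 n (λ j → sum1 n (summand j)) ∎
  where
  open Field F
  open FieldDefs F
  open FieldLemmas F
  open Expansion k a q la L m n
  open SetoidReasoning setoid
  ± : Carrier
  ± = (- 1#) ^ n
  qĈ : ℕ → Carrier
  qĈ j = q ^ (n ∸ j) * Chat k j m a q la L
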